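{- For positive integers $m,n$, let $G_{m,n}=\sum_{k=0}^{n-1}\frac{1}{(2k+1)(2k+2)\cdots(2k+m)}$. Then $$G_{m,n}=\sum_{k=1}^n\frac{(-1)^{k-1}}{(m-1)!\,(m+k-1)}\binom{n}{k}\,{}_2F_1(1,1-k;m+k;-1).$$
   Context: ${}_2F_1(a,b;c;x)=\sum_{i\ge0}\frac{(a)_i(b)_i}{(c)_i}\frac{x^i}{i!}$ with $(a)_0=1$, $(a)_i=a(a+1)\cdots(a+i-1)$; for $b=1-k$ with $k$ a positive integer the series terminates. -}

module Defs where

open import Data.Nat as ℕ using (ℕ; zero; suc)
open import Data.Nat.Combinatorics using (_C_)
open import Data.Nat using (_!)
open import Data.Integer as ℤ using (ℤ; +_)
open import Data.Rational as ℚ using (ℚ; _/_; 0ℚ; 1ℚ; _+_; _*_; -_)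

poch : ℚ → ℕ → ℚ
poch a zero    = 1ℚ
poch a (suc i) = poch a i * (a + (+ i / 1))

pochℕ : ℕ → ℕ → ℕ
pochℕ a zero    = 1
pochℕ a (suc i) = pochℕ a i ℕ.* (a ℕ.+ i)

sumTo : ℕ → (ℕ → ℚ) → ℚ
sumTo zero    f = 0ℚ
sumTo (suc n) f = sumTo n f + f n

-- reciprocal of a natural number (only ever applied to positive numbers;
-- the value at 0 is an irrelevant junk value 0)
recipℕ : ℕ → ℚ
recipℕ zero    = 0ℚ
recipℕ (suc n) = + 1 / suc n

fromℕ : ℕ → ℚ
fromℕ n = + n / 1

-- partial sum Σ_{i<N} (a)_i (b)_i / (c)_i * x^i / i!   with c a positive integer
-- (c ∈ ℕ so that (c)_i is a positive natural number)
hyp2F1Partial : ℚ → ℚ → ℕ → ℚ → ℕ → ℚ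
hyp2F1Partial a b c x N =
  sumTo N (λ i → poch a i * poch b i * recipℕ (pochℕ c i) * pow x i * recipℕ (i !))
  where
  pow : ℚ → ℕ → ℚ
  pow y zero    = 1ℚ
  pow y (suc j) = pow y j * y

-- terminating 2F1(a, 1-k; c; x) for k ≥ 1: terms with i ≥ k vanish since (1-k)_i = 0,
-- so the full series equals the partial sum over i < k
hyp2F1Term : ℚ → ℕ → ℕ → ℚ → ℚ
hyp2F1Term a k c x = hyp2F1Partial a (1ℚ ℚ.- fromℕ k) c x k

G : ℕ → ℕ → ℚ
G m n = sumTo n (λ k → recipℕ (pochℕ (2 ℕ.* k ℕ.+ 1) m))

sgn : ℕ → ℚ
sgn zero    = 1ℚ
sgn (suc j) = - sgn j

RHS : ℕ → ℕ → ℚ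
RHS m n = sumTo n (λ j → let k = suc j in
  sgn j * recipℕ (((m ℕ.∸ 1) !) ℕ.* (m ℕ.+ k ℕ.∸ 1)) * fromℕ (n C k)
        * hyp2F1Term 1ℚ k (m ℕ.+ k) (- 1ℚ))

-- Newton's forward-difference formula gives G m n = Σₖ C(n,k) Δᵏ(G m)(0), and Δᵏ⁺¹(G m)(0) = Δᵏ g(0)
-- for the summand g(x) = 1/(2x+1)ₘ = ∫₀¹ tᵐ⁻¹ (1-t)²ˣ dt / (m-1)!. Each difference multiplies the
-- integrand by (1-t)² - 1 = -t(2-t), so Δʲ g(0) = (-1)ʲ/(m-1)! · ∫₀¹ tᵃ (2-t)ʲ dt with a = m+j-1.
-- As functions of (a, b) these integrals and ₂F₁(1, -b; a+2; -1)/(a+1) both start at 1/(a+1) and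
-- satisfy X(a, b+1) = 2 X(a, b) - X(a+1, b), hence agree. The integrals are never formed: they are
-- generated from Beta values by (2-t) = 1 + (1-t), and only these finite recursions are used.
module Submission where

open import Defs
open import Data.Nat using (ℕ; _≥_)
open import Data.Rational using (ℚ)
open import Relation.Binary.PropositionalEquality using (_≡_)

open import Data.Nat as ℕ using (zero; suc; _!; NonZero)
open import Data.Nat.Combinatorics using (_C_; nCk+nC[k+1]≡[n+1]C[k+1]; k>n⇒nCk≡0)
import Data.Nat.Properties as ℕ
import Data.Integer as ℤ
import Data.Integer.Properties as ℤ
open import Data.Rational using (0ℚ; 1ℚ; _+_; _*_; -_; _-_; toℚᵘ)
open import Data.Rational.Properties
open import Data.Rational.Unnormalised as ℚᵘ using (mkℚᵘ; *≡*)
import Data.Rational.Unnormalised.Properties as ℚᵘ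
open import Data.Rational.Solver using (module +-*-Solver)
open import Data.Integer.Solver renaming (module +-*-Solver to ℤ-Solver)
open import Relation.Binary.PropositionalEquality
open ≡-Reasoning

toℚᵘ-fromℕ : ∀ n → toℚᵘ (fromℕ n) ℚᵘ.≃ mkℚᵘ (ℤ.+_ n) 0
toℚᵘ-fromℕ n = toℚᵘ-fromℚᵘ (mkℚᵘ (ℤ.+_ n) 0)

toℚᵘ-recipℕ : ∀ n → toℚᵘ (recipℕ (suc n)) ℚᵘ.≃ mkℚᵘ ℤ.1ℤ n
toℚᵘ-recipℕ n = toℚᵘ-fromℚᵘ (mkℚᵘ ℤ.1ℤ n)

toℚᵘ-≃⇒≡ : ∀ {p q x} → toℚᵘ p ℚᵘ.≃ x → toℚᵘ q ℚᵘ.≃ x → p ≡ q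
toℚᵘ-≃⇒≡ p≃x q≃x = toℚᵘ-injective (ℚᵘ.≃-trans p≃x (ℚᵘ.≃-sym q≃x))

fromℕ-+ : ∀ a b → fromℕ (a ℕ.+ b) ≡ fromℕ a + fromℕ b
fromℕ-+ a b = toℚᵘ-≃⇒≡ (toℚᵘ-fromℕ (a ℕ.+ b)) (ℚᵘ.≃-trans (toℚᵘ-homo-+ (fromℕ a) (fromℕ b))
  (ℚᵘ.≃-trans (ℚᵘ.+-cong (toℚᵘ-fromℕ a) (toℚᵘ-fromℕ b)) (*≡* (solve 2
    (λ x y → (x :* con ℤ.1ℤ :+ y :* con ℤ.1ℤ) :* con ℤ.1ℤ := (x :+ y) :* (con ℤ.1ℤ :* con ℤ.1ℤ))
    refl (ℤ.+_ a) (ℤ.+_ b)))))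
  where open ℤ-Solver

fromℕ-suc : ∀ n → fromℕ (suc n) ≡ 1ℚ + fromℕ n
fromℕ-suc = fromℕ-+ 1

fromℕ-* : ∀ a b → fromℕ (a ℕ.* b) ≡ fromℕ a * fromℕ b
fromℕ-* a b = toℚᵘ-≃⇒≡ (toℚᵘ-fromℕ (a ℕ.* b)) (ℚᵘ.≃-trans (toℚᵘ-homo-* (fromℕ a) (fromℕ b))
  (ℚᵘ.≃-trans (ℚᵘ.*-cong (toℚᵘ-fromℕ a) (toℚᵘ-fromℕ b)) (*≡* (cong (ℤ._* ℤ.1ℤ) (sym (ℤ.pos-* a b))))))

fromℕ-*-recipℕ : ∀ n .{{_ : NonZero n}} → fromℕ n * recipℕ n ≡ 1ℚ
fromℕ-*-recipℕ (suc n) = toℚᵘ-≃⇒≡ (ℚᵘ.≃-trans (toℚᵘ-homo-* (fromℕ (suc n)) (recipℕ (suc n)))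
  (ℚᵘ.*-cong (toℚᵘ-fromℕ (suc n)) (toℚᵘ-recipℕ n))) (*≡* (solve 1
    (λ x → con ℤ.1ℤ :* (con ℤ.1ℤ :* x) := (x :* con ℤ.1ℤ) :* con ℤ.1ℤ)
    refl (ℤ.+_ (suc n))))
  where open ℤ-Solver

-- The junk value recipℕ 0 = 0 makes this hold without side conditions.
recipℕ-* : ∀ a b → recipℕ (a ℕ.* b) ≡ recipℕ a * recipℕ b
recipℕ-* zero    b       = sym (*-zeroˡ (recipℕ b))
recipℕ-* (suc a) zero    = trans (cong recipℕ (ℕ.*-zeroʳ a)) (sym (*-zeroʳ (recipℕ (suc a))))
recipℕ-* (suc a) (suc b) = toℚᵘ-≃⇒≡ (toℚᵘ-recipℕ (b ℕ.+ a ℕ.* suc b))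
  (ℚᵘ.≃-trans (toℚᵘ-homo-* (recipℕ (suc a)) (recipℕ (suc b)))
  (ℚᵘ.≃-trans (ℚᵘ.*-cong (toℚᵘ-recipℕ a) (toℚᵘ-recipℕ b))
    (*≡* (trans (ℤ.*-identityˡ (ℤ.+_ (suc a) ℤ.* ℤ.+_ (suc b)))
                (sym (ℤ.*-identityˡ (ℤ.+_ (suc (b ℕ.+ a ℕ.* suc b)))))))))

open +-*-Solver

recipℕ-partial-fractions : ∀ x d →
  fromℕ d * (recipℕ (suc x) * recipℕ (suc x ℕ.+ d)) ≡ recipℕ (suc x) - recipℕ (suc x ℕ.+ d)
recipℕ-partial-fractions x d = begin
  fromℕ d * (u * w)
    ≡⟨ solve 4 (λ X D u w → D :* (u :* w) := (X :+ D) :* w :* u :- X :* u :* w)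
         refl (fromℕ (suc x)) (fromℕ d) u w ⟩
  (fromℕ (suc x) + fromℕ d) * w * u - fromℕ (suc x) * u * w
    ≡⟨ cong₂ (λ s t → s * w * u - t * w) (sym (fromℕ-+ (suc x) d)) (fromℕ-*-recipℕ (suc x)) ⟩
  fromℕ (suc x ℕ.+ d) * w * u - 1ℚ * w           ≡⟨ cong (λ s → s * u - 1ℚ * w) (fromℕ-*-recipℕ (suc x ℕ.+ d)) ⟩
  1ℚ * u - 1ℚ * w                                ≡⟨ cong₂ _-_ (*-identityˡ u) (*-identityˡ w) ⟩
  u - w                                          ∎
  where
  u = recipℕ (suc x)
  w = recipℕ (suc x ℕ.+ d)

-- Finite sums and Newton's forward-difference formula

sumTo-cong : ∀ n {f g : ℕ → ℚ} → (∀ i → f i ≡ g i) → sumTo n f ≡ sumTo n g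
sumTo-cong zero    f≡g = refl
sumTo-cong (suc n) f≡g = cong₂ _+_ (sumTo-cong n f≡g) (f≡g n)

sumTo-+ : ∀ n (f g : ℕ → ℚ) → sumTo n (λ i → f i + g i) ≡ sumTo n f + sumTo n g
sumTo-+ zero    f g = refl
sumTo-+ (suc n) f g = begin
  sumTo n (λ i → f i + g i) + (f n + g n) ≡⟨ cong (_+ (f n + g n)) (sumTo-+ n f g) ⟩
  sumTo n f + sumTo n g + (f n + g n)
    ≡⟨ solve 4 (λ a b c d → a :+ b :+ (c :+ d) := a :+ c :+ (b :+ d))
         refl (sumTo n f) (sumTo n g) (f n) (g n) ⟩
  sumTo n f + f n + (sumTo n g + g n)     ∎

sumTo-*ˡ : ∀ n c (f : ℕ → ℚ) → sumTo n (λ i → c * f i) ≡ c * sumTo n f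
sumTo-*ˡ zero    c f = sym (*-zeroʳ c)
sumTo-*ˡ (suc n) c f = trans (cong (_+ c * f n) (sumTo-*ˡ n c f)) (sym (*-distribˡ-+ c (sumTo n f) (f n)))

sumTo-head : ∀ n (f : ℕ → ℚ) → sumTo (suc n) f ≡ f 0 + sumTo n (λ i → f (suc i))
sumTo-head zero    f = trans (+-identityˡ (f 0)) (sym (+-identityʳ (f 0)))
sumTo-head (suc n) f = trans (cong (_+ f (suc n)) (sumTo-head n f)) (+-assoc (f 0) _ _)

Δ : ℕ → (ℕ → ℚ) → ℕ → ℚ
Δ zero    f x = f x
Δ (suc k) f x = Δ k f (suc x) - Δ k f x

Δ-cong : ∀ k {f g : ℕ → ℚ} → (∀ y → f y ≡ g y) → ∀ x → Δ k f x ≡ Δ k g x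
Δ-cong zero    f≡g x = f≡g x
Δ-cong (suc k) f≡g x = cong₂ _-_ (Δ-cong k f≡g (suc x)) (Δ-cong k f≡g x)

Δ-shift : ∀ k (f : ℕ → ℚ) x → Δ k (λ y → f (suc y)) x ≡ Δ k f (suc x)
Δ-shift zero    f x = refl
Δ-shift (suc k) f x = cong₂ _-_ (Δ-shift k f (suc x)) (Δ-shift k f x)

Δ-suc : ∀ k (f : ℕ → ℚ) x → Δ (suc k) f x ≡ Δ k (Δ 1 f) x
Δ-suc zero    f x = refl
Δ-suc (suc k) f x = cong₂ _-_ (Δ-suc k f (suc x)) (Δ-suc k f x)

binomialSum-extend : ∀ n (a : ℕ → ℚ) →
  sumTo (suc (suc n)) (λ k → fromℕ (n C k) * a k) ≡ sumTo (suc n) (λ k → fromℕ (n C k) * a k)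
binomialSum-extend n a = begin
  σ + fromℕ (n C suc n) * a (suc n) ≡⟨ cong (λ c → σ + fromℕ c * a (suc n)) (k>n⇒nCk≡0 (ℕ.n<1+n n)) ⟩
  σ + 0ℚ * a (suc n)                ≡⟨ cong (σ +_) (*-zeroˡ (a (suc n))) ⟩
  σ + 0ℚ                            ≡⟨ +-identityʳ σ ⟩
  σ                                 ∎
  where σ = sumTo (suc n) (λ k → fromℕ (n C k) * a k)

binomialSum-pascal : ∀ n (a : ℕ → ℚ) →
  sumTo (suc (suc n)) (λ k → fromℕ (suc n C k) * a k)
  ≡ sumTo (suc n) (λ k → fromℕ (n C k) * (a (suc k) + a k))
binomialSum-pascal n a = begin
  sumTo (suc (suc n)) (λ k → fromℕ (suc n C k) * a k)
    ≡⟨ sumTo-head (suc n) _ ⟩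
  a₀ + sumTo (suc n) (λ k → fromℕ (suc n C suc k) * a (suc k))
    ≡⟨ cong (a₀ +_) (trans (sumTo-cong (suc n) pascal) (sumTo-+ (suc n) _ _)) ⟩
  a₀ + (shifted + sumTo (suc n) (λ k → fromℕ (n C suc k) * a (suc k)))
    ≡⟨ solve 3 (λ x y z → x :+ (y :+ z) := y :+ (x :+ z)) refl a₀ shifted _ ⟩
  shifted + (a₀ + sumTo (suc n) (λ k → fromℕ (n C suc k) * a (suc k)))
    ≡⟨ cong (shifted +_) (trans (sym (sumTo-head (suc n) _)) (binomialSum-extend n a)) ⟩
  shifted + sumTo (suc n) (λ k → fromℕ (n C k) * a k)
    ≡⟨ sym (sumTo-+ (suc n) _ _) ⟩
  sumTo (suc n) (λ k → fromℕ (n C k) * a (suc k) + fromℕ (n C k) * a k)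
    ≡⟨ sumTo-cong (suc n) (λ k → sym (*-distribˡ-+ (fromℕ (n C k)) (a (suc k)) (a k))) ⟩
  sumTo (suc n) (λ k → fromℕ (n C k) * (a (suc k) + a k)) ∎
  where
  a₀ = fromℕ 1 * a 0
  shifted = sumTo (suc n) (λ k → fromℕ (n C k) * a (suc k))
  pascal : ∀ k → fromℕ (suc n C suc k) * a (suc k) ≡ fromℕ (n C k) * a (suc k) + fromℕ (n C suc k) * a (suc k)
  pascal k = begin
    fromℕ (suc n C suc k) * a (suc k)
      ≡⟨ cong (λ c → fromℕ c * a (suc k)) (sym (nCk+nC[k+1]≡[n+1]C[k+1] n k)) ⟩
    fromℕ (n C k ℕ.+ n C suc k) * a (suc k)           ≡⟨ cong (_* a (suc k)) (fromℕ-+ (n C k) (n C suc k)) ⟩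
    (fromℕ (n C k) + fromℕ (n C suc k)) * a (suc k)   ≡⟨ *-distribʳ-+ (a (suc k)) (fromℕ (n C k)) (fromℕ (n C suc k)) ⟩
    fromℕ (n C k) * a (suc k) + fromℕ (n C suc k) * a (suc k) ∎

newton : ∀ n (f : ℕ → ℚ) → f n ≡ sumTo (suc n) (λ k → fromℕ (n C k) * Δ k f 0)
newton zero    f = sym (trans (+-identityˡ _) (*-identityˡ (f 0)))
newton (suc n) f = begin
  f (suc n)                                                      ≡⟨ newton n (λ y → f (suc y)) ⟩
  sumTo (suc n) (λ k → fromℕ (n C k) * Δ k (λ y → f (suc y)) 0)
    ≡⟨ sumTo-cong (suc n) (λ k → cong (fromℕ (n C k) *_) (trans (Δ-shift k f 0) (Δ-step k))) ⟩
  sumTo (suc n) (λ k → fromℕ (n C k) * (Δ (suc k) f 0 + Δ k f 0)) ≡⟨ sym (binomialSum-pascal n (λ k → Δ k f 0)) ⟩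
  sumTo (suc (suc n)) (λ k → fromℕ (suc n C k) * Δ k f 0)        ∎
  where
  Δ-step : ∀ k → Δ k f 1 ≡ Δ (suc k) f 0 + Δ k f 0
  Δ-step k = solve 2 (λ x y → x := x :- y :+ y) refl (Δ k f 1) (Δ k f 0)

pochℕ-suc-head : ∀ x k → pochℕ x (suc k) ≡ x ℕ.* pochℕ (suc x) k
pochℕ-suc-head x zero    = trans (ℕ.*-identityˡ (x ℕ.+ 0)) (trans (ℕ.+-identityʳ x) (sym (ℕ.*-identityʳ x)))
pochℕ-suc-head x (suc k) = begin
  pochℕ x (suc k) ℕ.* (x ℕ.+ suc k)            ≡⟨ cong₂ ℕ._*_ (pochℕ-suc-head x k) (ℕ.+-suc x k) ⟩
  x ℕ.* pochℕ (suc x) k ℕ.* (suc x ℕ.+ k)      ≡⟨ ℕ.*-assoc x _ _ ⟩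
  x ℕ.* (pochℕ (suc x) k ℕ.* (suc x ℕ.+ k))    ∎

pochℕ-one : ∀ n → pochℕ 1 n ≡ n !
pochℕ-one zero    = refl
pochℕ-one (suc n) = trans (cong (ℕ._* suc n) (pochℕ-one n)) (ℕ.*-comm (n !) (suc n))

-- B a b p = ∫₀¹ tᵃ (1-t)ᵖ (2-t)ᵇ dt; for b = 0 it is the Beta value a! p! / (a+p+1)!.
B : ℕ → ℕ → ℕ → ℚ
B a zero    p = fromℕ (a !) * recipℕ (pochℕ (suc p) (suc a))
B a (suc b) p = B a b p + B a b (suc p)

-- tᵃ⁺¹ = tᵃ - tᵃ (1-t) under the integral.
B-suc₁ : ∀ a b p → B (suc a) b p ≡ B a b p - B a b (suc p)
B-suc₁ a zero p = begin
  fromℕ (suc a ℕ.* a !) * recipℕ (pochℕ (suc p) (suc a) ℕ.* q)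
    ≡⟨ cong₂ _*_ (fromℕ-* (suc a) (a !)) (trans (recipℕ-* (pochℕ (suc p) (suc a)) q) (cong (_* w) uv)) ⟩
  fromℕ (suc a) * A * (u * v * w)
    ≡⟨ solve 5 (λ d A u v w → d :* A :* (u :* v :* w) := A :* v :* (d :* (u :* w))) refl (fromℕ (suc a)) A u v w ⟩
  A * v * (fromℕ (suc a) * (u * w))  ≡⟨ cong (A * v *_) (recipℕ-partial-fractions p (suc a)) ⟩
  A * v * (u - w)
    ≡⟨ solve 4 (λ A u v w → A :* v :* (u :- w) := A :* (u :* v) :- A :* (v :* w))
         refl A u v w ⟩
  A * (u * v) - A * (v * w)          ≡⟨ cong₂ (λ s t → A * s - A * t) (sym uv) (sym vw) ⟩
  A * recipℕ (pochℕ (suc p) (suc a)) - A * recipℕ (pochℕ (suc (suc p)) (suc a)) ∎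
  where
  P = pochℕ (suc (suc p)) a
  q = suc p ℕ.+ suc a
  A = fromℕ (a !)
  u = recipℕ (suc p)
  v = recipℕ P
  w = recipℕ q
  uv : recipℕ (pochℕ (suc p) (suc a)) ≡ u * v
  uv = trans (cong recipℕ (pochℕ-suc-head (suc p) a)) (recipℕ-* (suc p) P)
  vw : recipℕ (pochℕ (suc (suc p)) (suc a)) ≡ v * w
  vw = trans (cong (λ n → recipℕ (P ℕ.* n)) (sym (ℕ.+-suc (suc p) a))) (recipℕ-* P q)
B-suc₁ a (suc b) p = begin
  B (suc a) b p + B (suc a) b (suc p)                 ≡⟨ cong₂ _+_ (B-suc₁ a b p) (B-suc₁ a b (suc p)) ⟩
  (B a b p - B a b (suc p)) + (B a b (suc p) - B a b (suc (suc p)))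
    ≡⟨ solve 3 (λ x y z → (x :- y) :+ (y :- z) := (x :+ y) :- (y :+ z))
         refl (B a b p) (B a b (suc p)) (B a b (suc (suc p))) ⟩
  (B a b p + B a b (suc p)) - (B a b (suc p) + B a b (suc (suc p))) ∎

B-suc₁₂ : ∀ a b p → B (suc a) (suc b) p ≡ B a b p - B a b (suc (suc p))
B-suc₁₂ a b p = begin
  B (suc a) b p + B (suc a) b (suc p)  ≡⟨ cong₂ _+_ (B-suc₁ a b p) (B-suc₁ a b (suc p)) ⟩
  (B a b p - B a b (suc p)) + (B a b (suc p) - B a b (suc (suc p)))
    ≡⟨ solve 3 (λ x y z → (x :- y) :+ (y :- z) := x :- z) refl (B a b p) (B a b (suc p)) (B a b (suc (suc p))) ⟩
  B a b p - B a b (suc (suc p))        ∎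

g : ℕ → ℕ → ℚ
g m k = recipℕ (pochℕ (2 ℕ.* k ℕ.+ 1) m)

-- 1/(2x+1)ₘ = B (m-1) 0 (2x) / (m-1)!, and Δ multiplies the integrand by (1-t)² - 1 = -t(2-t).
Δ-g : ∀ m k x → Δ k (g (suc m)) x ≡ sgn k * recipℕ (m !) * B (k ℕ.+ m) k (2 ℕ.* x)
Δ-g m zero x = begin
  recipℕ (pochℕ (2 ℕ.* x ℕ.+ 1) (suc m)) ≡⟨ cong (λ y → recipℕ (pochℕ y (suc m))) (ℕ.+-comm (2 ℕ.* x) 1) ⟩
  R                                      ≡⟨ sym (*-identityˡ R) ⟩
  1ℚ * R                                 ≡⟨ cong (_* R) (sym (fromℕ-*-recipℕ (m !) {{m ℕ.!≢0}})) ⟩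
  fromℕ (m !) * recipℕ (m !) * R
    ≡⟨ solve 3 (λ f c R → f :* c :* R := con 1ℚ :* c :* (f :* R))
         refl (fromℕ (m !)) (recipℕ (m !)) R ⟩
  1ℚ * recipℕ (m !) * (fromℕ (m !) * R)  ∎
  where R = recipℕ (pochℕ (suc (2 ℕ.* x)) (suc m))
Δ-g m (suc k) x = begin
  Δ k (g (suc m)) (suc x) - Δ k (g (suc m)) x     ≡⟨ cong₂ _-_ (Δ-g m k (suc x)) (Δ-g m k x) ⟩
  s * c * B a k (2 ℕ.* suc x) - s * c * B a k (2 ℕ.* x)
    ≡⟨ cong (λ y → s * c * B a k y - s * c * B a k (2 ℕ.* x)) (ℕ.*-distribˡ-+ 2 1 x) ⟩
  s * c * B a k (2 ℕ.+ 2 ℕ.* x) - s * c * B a k (2 ℕ.* x)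
    ≡⟨ solve 4 (λ s c u v → s :* c :* v :- s :* c :* u := (:- s) :* c :* (u :- v))
         refl s c (B a k (2 ℕ.* x)) (B a k (2 ℕ.+ 2 ℕ.* x)) ⟩
  (- s) * c * (B a k (2 ℕ.* x) - B a k (2 ℕ.+ 2 ℕ.* x)) ≡⟨ cong ((- s) * c *_) (sym (B-suc₁₂ a k (2 ℕ.* x))) ⟩
  (- s) * c * B (suc a) (suc k) (2 ℕ.* x)          ∎
  where
  s = sgn k
  c = recipℕ (m !)
  a = k ℕ.+ m

B-zero-zero : ∀ a → B a zero 0 ≡ recipℕ (suc a)
B-zero-zero a = begin
  fromℕ (a !) * recipℕ (pochℕ 1 (suc a))     ≡⟨ cong (λ n → fromℕ (a !) * recipℕ n) (pochℕ-one (suc a)) ⟩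
  fromℕ (a !) * recipℕ (suc a ℕ.* a !)       ≡⟨ cong (fromℕ (a !) *_) (recipℕ-* (suc a) (a !)) ⟩
  fromℕ (a !) * (recipℕ (suc a) * recipℕ (a !))
    ≡⟨ solve 3 (λ f r c → f :* (r :* c) := r :* (f :* c)) refl (fromℕ (a !)) (recipℕ (suc a)) (recipℕ (a !)) ⟩
  recipℕ (suc a) * (fromℕ (a !) * recipℕ (a !)) ≡⟨ cong (recipℕ (suc a) *_) (fromℕ-*-recipℕ (a !) {{a ℕ.!≢0}}) ⟩
  recipℕ (suc a) * 1ℚ                         ≡⟨ *-identityʳ _ ⟩
  recipℕ (suc a)                              ∎

B-suc₂-at-zero : ∀ a b → B a (suc b) 0 ≡ B a b 0 + B a b 0 - B (suc a) b 0
B-suc₂-at-zero a b = begin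
  B a b 0 + B a b 1                        ≡⟨ solve 2 (λ x y → x :+ y := x :+ x :- (x :- y)) refl (B a b 0) (B a b 1) ⟩
  B a b 0 + B a b 0 - (B a b 0 - B a b 1)  ≡⟨ cong (λ x → B a b 0 + B a b 0 - x) (sym (B-suc₁ a b 0)) ⟩
  B a b 0 + B a b 0 - B (suc a) b 0        ∎

recipℕ-*-recipℕ-suc : ∀ a → recipℕ (suc a) * recipℕ (suc (suc a)) ≡ recipℕ (suc a) - recipℕ (suc (suc a))
recipℕ-*-recipℕ-suc a = subst (λ n → recipℕ (suc a) * recipℕ n ≡ recipℕ (suc a) - recipℕ n) (ℕ.+-comm (suc a) 1)
  (trans (sym (*-identityˡ _)) (recipℕ-partial-fractions a 1))

-- The recursion shared by B a b 0 and ₂F₁(1, -b; a+2; -1) / (a+1).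
S : ℕ → ℕ → ℚ
S a zero    = recipℕ (suc a)
S a (suc b) = recipℕ (suc a) * (1ℚ + fromℕ (suc b) * S (suc a) b)

S-suc : ∀ b a → S a (suc b) ≡ S a b + S a b - S (suc a) b
S-suc zero a = begin
  r₁ * (1ℚ + 1ℚ * r₂) ≡⟨ solve 2 (λ r₁ r₂ → r₁ :* (con 1ℚ :+ con 1ℚ :* r₂) := r₁ :+ r₁ :* r₂) refl r₁ r₂ ⟩
  r₁ + r₁ * r₂        ≡⟨ cong (r₁ +_) (recipℕ-*-recipℕ-suc a) ⟩
  r₁ + (r₁ - r₂)      ≡⟨ solve 2 (λ r₁ r₂ → r₁ :+ (r₁ :- r₂) := r₁ :+ r₁ :- r₂) refl r₁ r₂ ⟩
  r₁ + r₁ - r₂        ∎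
  where
  r₁ = recipℕ (suc a)
  r₂ = recipℕ (suc (suc a))
S-suc (suc b) a = begin
  r₁ * (1ℚ + fromℕ (suc (suc b)) * (r₂ * W))       ≡⟨ cong (λ x → r₁ * (1ℚ + x * (r₂ * W))) (fromℕ-suc (suc b)) ⟩
  r₁ * (1ℚ + (1ℚ + β) * (r₂ * W))
    ≡⟨ solve 4 (λ r₁ r₂ β W → r₁ :* (con 1ℚ :+ (con 1ℚ :+ β) :* (r₂ :* W)) := r₁ :+ r₁ :* r₂ :* W :+ r₁ :* (β :* (r₂ :* W)))
             refl r₁ r₂ β W ⟩
  r₁ + r₁ * r₂ * W + r₁ * (β * (r₂ * W))
    ≡⟨ cong₂ (λ x y → r₁ + x * W + r₁ * (β * y)) (recipℕ-*-recipℕ-suc a) (S-suc b (suc a)) ⟩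
  r₁ + (r₁ - r₂) * W + r₁ * (β * (Z + Z - Y))
    ≡⟨ solve 5 (λ r₁ r₂ β Y Z → r₁ :+ (r₁ :- r₂) :* (con 1ℚ :+ β :* Y) :+ r₁ :* (β :* (Z :+ Z :- Y))
                 := r₁ :* (con 1ℚ :+ β :* Z) :+ r₁ :* (con 1ℚ :+ β :* Z) :- r₂ :* (con 1ℚ :+ β :* Y))
             refl r₁ r₂ β Y Z ⟩
  r₁ * (1ℚ + β * Z) + r₁ * (1ℚ + β * Z) - r₂ * W   ∎
  where
  r₁ = recipℕ (suc a)
  r₂ = recipℕ (suc (suc a))
  β = fromℕ (suc b)
  Y = S (suc (suc a)) b
  Z = S (suc a) b
  W = 1ℚ + β * Y

B≡S : ∀ b a → B a b 0 ≡ S a b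
B≡S zero    a = B-zero-zero a
B≡S (suc b) a = begin
  B a (suc b) 0                     ≡⟨ B-suc₂-at-zero a b ⟩
  B a b 0 + B a b 0 - B (suc a) b 0 ≡⟨ cong₂ (λ x y → x + x - y) (B≡S b a) (B≡S b (suc a)) ⟩
  S a b + S a b - S (suc a) b       ≡⟨ sym (S-suc b a) ⟩
  S a (suc b)                       ∎

-- The hypergeometric side

poch-suc-head : ∀ x i → poch x (suc i) ≡ x * poch (x + 1ℚ) i
poch-suc-head x zero    = solve 1 (λ x → con 1ℚ :* (x :+ con 0ℚ) := x :* con 1ℚ) refl x
poch-suc-head x (suc i) = begin
  poch x (suc i) * (x + fromℕ (suc i))        ≡⟨ cong₂ (λ p f → p * (x + f)) (poch-suc-head x i) (fromℕ-suc i) ⟩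
  x * poch (x + 1ℚ) i * (x + (1ℚ + fromℕ i))
    ≡⟨ solve 3 (λ x p f → x :* p :* (x :+ (con 1ℚ :+ f)) := x :* (p :* (x :+ con 1ℚ :+ f)))
         refl x (poch (x + 1ℚ) i) (fromℕ i) ⟩
  x * (poch (x + 1ℚ) i * (x + 1ℚ + fromℕ i))   ∎

poch-one : ∀ i → poch 1ℚ i ≡ fromℕ (i !)
poch-one zero    = refl
poch-one (suc i) = begin
  poch 1ℚ i * (1ℚ + fromℕ i)     ≡⟨ cong₂ _*_ (poch-one i) (sym (fromℕ-suc i)) ⟩
  fromℕ (i !) * fromℕ (suc i)    ≡⟨ sym (fromℕ-* (i !) (suc i)) ⟩
  fromℕ (i ! ℕ.* suc i)          ≡⟨ cong fromℕ (ℕ.*-comm (i !) (suc i)) ⟩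
  fromℕ (suc i !)                ∎

-- hyp2F1 b c is ₂F₁(1, -b; c; -1), each term with its factor (1)ᵢ / i! = 1 removed.
hyp2F1 : ℕ → ℕ → ℚ
hyp2F1 b c = sumTo (suc b) (λ i → poch (- fromℕ b) i * recipℕ (pochℕ c i) * sgn i)

hyp2F1-suc : ∀ b c → hyp2F1 (suc b) c ≡ 1ℚ + fromℕ (suc b) * recipℕ c * hyp2F1 b (suc c)
hyp2F1-suc b c = begin
  hyp2F1 (suc b) c                                                ≡⟨ sumTo-head (suc b) _ ⟩
  1ℚ + sumTo (suc b) (λ i → poch (- β) (suc i) * recipℕ (pochℕ c (suc i)) * sgn (suc i))
    ≡⟨ cong (1ℚ +_) (sumTo-cong (suc b) term) ⟩
  1ℚ + sumTo (suc b) (λ i → β * recipℕ c * (poch (- fromℕ b) i * recipℕ (pochℕ (suc c) i) * sgn i))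
    ≡⟨ cong (1ℚ +_) (sumTo-*ˡ (suc b) (β * recipℕ c) _) ⟩
  1ℚ + β * recipℕ c * hyp2F1 b (suc c)                             ∎
  where
  β = fromℕ (suc b)
  -β+1 : - β + 1ℚ ≡ - fromℕ b
  -β+1 = trans (cong (λ x → - x + 1ℚ) (fromℕ-suc b)) (solve 1 (λ x → :- (con 1ℚ :+ x) :+ con 1ℚ := :- x) refl (fromℕ b))
  term : ∀ i → poch (- β) (suc i) * recipℕ (pochℕ c (suc i)) * sgn (suc i)
             ≡ β * recipℕ c * (poch (- fromℕ b) i * recipℕ (pochℕ (suc c) i) * sgn i)
  term i = begin
    poch (- β) (suc i) * recipℕ (pochℕ c (suc i)) * - sgn i
      ≡⟨ cong₂ (λ p r → p * r * - sgn i) (poch-suc-head (- β) i)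
               (trans (cong recipℕ (pochℕ-suc-head c i)) (recipℕ-* c (pochℕ (suc c) i))) ⟩
    - β * poch (- β + 1ℚ) i * (recipℕ c * R) * - sgn i
      ≡⟨ cong (λ x → - β * poch x i * (recipℕ c * R) * - sgn i) -β+1 ⟩
    - β * poch (- fromℕ b) i * (recipℕ c * R) * - sgn i
      ≡⟨ solve 5 (λ β p r R s → :- β :* p :* (r :* R) :* (:- s) := β :* r :* (p :* R :* s))
           refl β (poch (- fromℕ b) i) (recipℕ c) R (sgn i) ⟩
    β * recipℕ c * (poch (- fromℕ b) i * R * sgn i) ∎
    where R = recipℕ (pochℕ (suc c) i)

S≡hyp2F1 : ∀ b a → S a b ≡ recipℕ (suc a) * hyp2F1 b (suc (suc a))
S≡hyp2F1 zero    a = sym (*-identityʳ (recipℕ (suc a)))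
S≡hyp2F1 (suc b) a = begin
  r₁ * (1ℚ + β * S (suc a) b)          ≡⟨ cong (λ x → r₁ * (1ℚ + β * x)) (S≡hyp2F1 b (suc a)) ⟩
  r₁ * (1ℚ + β * (r₂ * h))             ≡⟨ cong (λ x → r₁ * (1ℚ + x)) (sym (*-assoc β r₂ h)) ⟩
  r₁ * (1ℚ + β * r₂ * h)               ≡⟨ cong (r₁ *_) (sym (hyp2F1-suc b (suc (suc a)))) ⟩
  r₁ * hyp2F1 (suc b) (suc (suc a))    ∎
  where
  r₁ = recipℕ (suc a)
  r₂ = recipℕ (suc (suc a))
  β = fromℕ (suc b)
  h = hyp2F1 b (suc (suc (suc a)))

sgn-unique : (pw : ℕ → ℚ) → pw 0 ≡ 1ℚ → (∀ j → pw (suc j) ≡ pw j * - 1ℚ) → ∀ j → pw j ≡ sgn j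
sgn-unique pw pw0 pw-suc zero    = pw0
sgn-unique pw pw0 pw-suc (suc j) = begin
  pw (suc j)     ≡⟨ pw-suc j ⟩
  pw j * - 1ℚ    ≡⟨ cong (_* - 1ℚ) (sgn-unique pw pw0 pw-suc j) ⟩
  sgn j * - 1ℚ   ≡⟨ solve 1 (λ s → s :* (:- con 1ℚ) := :- s) refl (sgn j) ⟩
  - sgn j        ∎

-- The powers in hyp2F1Partial come from a where-bound helper that cannot be named here;
-- unification recovers it as the function pw below.
hyp2F1Partial-at-minus-one : ∀ a b c N →
  hyp2F1Partial a b c (- 1ℚ) N ≡ sumTo N (λ i → poch a i * poch b i * recipℕ (pochℕ c i) * sgn i * recipℕ (i !))
hyp2F1Partial-at-minus-one a b c N = summands-agree _ refl (λ _ → refl)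
  where
  summands-agree : (pw : ℕ → ℚ) → pw 0 ≡ 1ℚ → (∀ j → pw (suc j) ≡ pw j * - 1ℚ) →
    sumTo N (λ i → poch a i * poch b i * recipℕ (pochℕ c i) * pw i * recipℕ (i !))
    ≡ sumTo N (λ i → poch a i * poch b i * recipℕ (pochℕ c i) * sgn i * recipℕ (i !))
  summands-agree pw pw0 pw-suc = sumTo-cong N (λ i →
    cong (λ s → poch a i * poch b i * recipℕ (pochℕ c i) * s * recipℕ (i !)) (sgn-unique pw pw0 pw-suc i))

hyp2F1Term≡hyp2F1 : ∀ b c → hyp2F1Term 1ℚ (suc b) c (- 1ℚ) ≡ hyp2F1 b c
hyp2F1Term≡hyp2F1 b c = trans (hyp2F1Partial-at-minus-one 1ℚ _ c (suc b)) (sumTo-cong (suc b) term)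
  where
  1-k : 1ℚ - fromℕ (suc b) ≡ - fromℕ b
  1-k = trans (cong (λ x → 1ℚ - x) (fromℕ-suc b)) (solve 1 (λ x → con 1ℚ :- (con 1ℚ :+ x) := :- x) refl (fromℕ b))
  term : ∀ i → poch 1ℚ i * poch (1ℚ - fromℕ (suc b)) i * recipℕ (pochℕ c i) * sgn i * recipℕ (i !)
             ≡ poch (- fromℕ b) i * recipℕ (pochℕ c i) * sgn i
  term i = begin
    poch 1ℚ i * poch (1ℚ - fromℕ (suc b)) i * R * sgn i * recipℕ (i !)
      ≡⟨ cong₂ (λ f x → f * poch x i * R * sgn i * recipℕ (i !)) (poch-one i) 1-k ⟩
    fromℕ (i !) * p * R * sgn i * recipℕ (i !)
      ≡⟨ solve 5 (λ f p R s c → f :* p :* R :* s :* c := p :* R :* s :* (f :* c))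
           refl (fromℕ (i !)) p R (sgn i) (recipℕ (i !)) ⟩
    p * R * sgn i * (fromℕ (i !) * recipℕ (i !)) ≡⟨ cong (p * R * sgn i *_) (fromℕ-*-recipℕ (i !) {{i ℕ.!≢0}}) ⟩
    p * R * sgn i * 1ℚ                          ≡⟨ *-identityʳ _ ⟩
    p * R * sgn i                               ∎
    where
    p = poch (- fromℕ b) i
    R = recipℕ (pochℕ c i)

Δ-G : ∀ m k x → Δ (suc k) (G m) x ≡ Δ k (g m) x
Δ-G m k x = trans (Δ-suc k (G m) x) (Δ-cong k (λ y → solve 2 (λ s t → s :+ t :- s := t) refl (G m y) (g m y)) x)

Δ-G-at-zero : ∀ m j →
  Δ (suc j) (G (suc m)) 0 ≡ sgn j * recipℕ (m ! ℕ.* (m ℕ.+ suc j)) * hyp2F1Term 1ℚ (suc j) (suc m ℕ.+ suc j) (- 1ℚ)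
Δ-G-at-zero m j = begin
  Δ (suc j) (G (suc m)) 0                        ≡⟨ Δ-G (suc m) j 0 ⟩
  Δ j (g (suc m)) 0                              ≡⟨ Δ-g m j 0 ⟩
  sgn j * recipℕ (m !) * B a j 0                 ≡⟨ cong (sgn j * recipℕ (m !) *_) (trans (B≡S j a) (S≡hyp2F1 j a)) ⟩
  sgn j * recipℕ (m !) * (recipℕ (suc a) * hyp2F1 j (suc (suc a)))
    ≡⟨ solve 4 (λ s c r h → s :* c :* (r :* h) := s :* (c :* r) :* h)
         refl (sgn j) (recipℕ (m !)) (recipℕ (suc a)) (hyp2F1 j (suc (suc a))) ⟩
  sgn j * (recipℕ (m !) * recipℕ (suc a)) * hyp2F1 j (suc (suc a))
    ≡⟨ cong₂ (λ r h → sgn j * r * h)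
             (sym (trans (cong (λ n → recipℕ (m ! ℕ.* n)) m+[1+j]) (recipℕ-* (m !) (suc a))))
             (sym (trans (hyp2F1Term≡hyp2F1 j _) (cong (hyp2F1 j) (cong suc m+[1+j])))) ⟩
  sgn j * recipℕ (m ! ℕ.* (m ℕ.+ suc j)) * hyp2F1Term 1ℚ (suc j) (suc m ℕ.+ suc j) (- 1ℚ) ∎
  where
  a = j ℕ.+ m
  m+[1+j] : m ℕ.+ suc j ≡ suc a
  m+[1+j] = trans (ℕ.+-suc m j) (cong suc (ℕ.+-comm m j))

-- The identity also holds for n = 0, where both sides are empty sums.
proposition3p5 : (m n : ℕ) → m ≥ 1 → n ≥ 1 → G m n ≡ RHS m n
proposition3p5 (suc m) n _ _ = begin
  G (suc m) n                                                          ≡⟨ newton n (G (suc m)) ⟩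
  sumTo (suc n) (λ k → fromℕ (n C k) * Δ k (G (suc m)) 0)             ≡⟨ sumTo-head n _ ⟩
  0ℚ + sumTo n (λ j → fromℕ (n C suc j) * Δ (suc j) (G (suc m)) 0)    ≡⟨ +-identityˡ _ ⟩
  sumTo n (λ j → fromℕ (n C suc j) * Δ (suc j) (G (suc m)) 0)         ≡⟨ sumTo-cong n term ⟩
  RHS (suc m) n                                                        ∎
  where
  term : ∀ j → fromℕ (n C suc j) * Δ (suc j) (G (suc m)) 0
             ≡ sgn j * recipℕ (m ! ℕ.* (m ℕ.+ suc j)) * fromℕ (n C suc j) * hyp2F1Term 1ℚ (suc j) (suc m ℕ.+ suc j) (- 1ℚ)
  term j = trans (cong (fromℕ (n C suc j) *_) (Δ-G-at-zero m j))
    (solve 4 (λ c s r h → c :* (s :* r :* h) := s :* r :* c :* h) refl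
      (fromℕ (n C suc j)) (sgn j) (recipℕ (m ! ℕ.* (m ℕ.+ suc j))) (hyp2F1Term 1ℚ (suc j) (suc m ℕ.+ suc j) (- 1ℚ)))
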